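{- Let $H$ be a square-free graph, $C=\theta\gamma_1\gamma_2\cdots\gamma_k\theta$ a cycle in $H$ of length at least three, and $\Delta=\{\gamma_1,\gamma_k\}$. Let $\mathcal J_{CL}$ and $\mathcal J_{CR}$ be the cycle vertex gadgets of $C$. Then: (1) if $\sigma\in\mathsf{Hom}(\mathcal J_{CL},H)$ then $\sigma(s)\in\{\gamma_1,\gamma_k\}$, and if $\sigma\in\mathsf{Hom}(\mathcal J_{CR},H)$ then $\sigma(t)\in\{\gamma_1,\gamma_k\}$; (2) for any $\gamma\in\Delta$, $|\mathsf{Hom}((\mathcal J_{CL},s),(H,\gamma))|=|\mathsf{Hom}((\mathcal J_{CR},t),(H,\gamma))|=1$; (3) for any $\gamma'\notin\Delta$, $\mathsf{Hom}((\mathcal J_{CL},s),(H,\gamma'))=\mathsf{Hom}((\mathcal J_{CR},t),(H,\gamma'))=\emptyset$.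
   Context: Graphs are finite, undirected, loopless, without parallel edges; square-free means no cycle of length 4. A partial $H$-labelled graph is a graph with a partial pinning function to $V(H)$; $\mathsf{Hom}(\mathcal G,H)$ is the set of graph homomorphisms extending the pinning, and $\mathsf{Hom}((\mathcal G,x),(H,y))$ those additionally mapping $x$ to $y$. The gadget $\mathcal J_{CL}=(J_{CL},\tau)$: $V(J_{CL})=\{s,x\}\cup\{v_i,u_i: i\in\{1,\dots,k\}\}$, $E(J_{CL})=\{v_iv_{i+1}: 1\le i\le k-1\}\cup\{v_iu_i:1\le i\le k\}\cup\{sv_1,v_ks,sx\}$, with pinning $\tau(u_i)=\gamma_i$ for $i\in\{1,\dots,k\}$ and $\tau(x)=\theta$. The gadget $\mathcal J_{CR}$ is defined identically with $s$ renamed $t$ (and $x$ renamed $y$). -}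

module Defs where

open import Data.Nat using (ℕ; zero; suc; _≤_)
open import Data.Fin using (Fin; toℕ)
open import Data.Product using (Σ; _×_; _,_)
open import Data.Sum using (_⊎_)
open import Relation.Binary.PropositionalEquality using (_≡_; _≢_)
open import Relation.Nullary using (¬_)
open import Function.Definitions using (Injective)

record Graph : Set₁ where
  field
    n     : ℕ
    Adj   : Fin n → Fin n → Set
    sym   : ∀ {a b} → Adj a b → Adj b a
    irrefl : ∀ {a} → ¬ Adj a a
open Graph public

SquareFree : Graph → Set
SquareFree H = ∀ (a b c d : Fin (n H)) →
  a ≢ b → a ≢ c → a ≢ d → b ≢ c → b ≢ d → c ≢ d →
  Adj H a b → Adj H b c → Adj H c d → ¬ Adj H d a

-- C = θ γ₁ γ₂ ⋯ γ_k θ is a cycle of H of length k+1 ≥ 3.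
-- γ is indexed by Fin k: index i stands for γ_{toℕ i + 1}.
record IsCycle (H : Graph) (k : ℕ) (θ : Fin (n H)) (γ : Fin k → Fin (n H)) : Set where
  field
    len     : 2 ≤ k
    γ-inj   : Injective _≡_ _≡_ γ
    θ-fresh : ∀ i → γ i ≢ θ
    first   : ∀ i → toℕ i ≡ 0 → Adj H θ (γ i)
    step    : ∀ i j → toℕ j ≡ suc (toℕ i) → Adj H (γ i) (γ j)
    last    : ∀ i → suc (toℕ i) ≡ k → Adj H (γ i) θ

-- Vertex set of the cycle vertex gadget: the centre c (called s in J_CL and
-- t in J_CR), x (called y in J_CR), v_i and u_i for i ∈ Fin k.
data GV (k : ℕ) : Set where
  c  : GV k
  x  : GV k
  v  : Fin k → GV k
  u  : Fin k → GV k

-- Edges of the gadget (unordered: each edge listed once, a homomorphism must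
-- map it to an edge of H; H's adjacency is symmetric).
data GE (k : ℕ) : GV k → GV k → Set where
  e-vv : ∀ i j → toℕ j ≡ suc (toℕ i) → GE k (v i) (v j)
  e-vu : ∀ i → GE k (v i) (u i)
  e-sv1 : ∀ i → toℕ i ≡ 0 → GE k c (v i)
  e-vks : ∀ i → suc (toℕ i) ≡ k → GE k (v i) c
  e-sx : GE k c x

record IsGadgetHom (H : Graph) (k : ℕ) (θ : Fin (n H)) (γ : Fin k → Fin (n H))
                   (σ : GV k → Fin (n H)) : Set where
  field
    hom   : ∀ a b → GE k a b → Adj H (σ a) (σ b)
    pin-u : ∀ i → σ (u i) ≡ γ i
    pin-x : σ x ≡ θ

HomJ : (H : Graph) (k : ℕ) (θ : Fin (n H)) (γ : Fin k → Fin (n H)) → Set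
HomJ H k θ γ = Σ (GV k → Fin (n H)) (IsGadgetHom H k θ γ)

IsHomAt : (H : Graph) (k : ℕ) (θ : Fin (n H)) (γ : Fin k → Fin (n H)) → Fin (n H)
          → (GV k → Fin (n H)) → Set
IsHomAt H k θ γ g σ = IsGadgetHom H k θ γ σ × σ c ≡ g

-- The two gadgets J_CL (centre s, pendant x) and J_CR (centre t, pendant y)
-- are identical up to renaming, so they share this representation.
IsHomJCL IsHomJCR : (H : Graph) (k : ℕ) (θ : Fin (n H)) (γ : Fin k → Fin (n H))
                    → (GV k → Fin (n H)) → Set
IsHomJCL = IsGadgetHom
IsHomJCR = IsGadgetHom

IsHomJCL-at IsHomJCR-at : (H : Graph) (k : ℕ) (θ : Fin (n H)) (γ : Fin k → Fin (n H))
                          → Fin (n H) → (GV k → Fin (n H)) → Set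
IsHomJCL-at = IsHomAt
IsHomJCR-at = IsHomAt

CardOne : {A B : Set} → ((A → B) → Set) → Set
CardOne {A} {B} P = Σ (A → B) P × (∀ σ σ' → P σ → P σ' → ∀ a → σ a ≡ σ' a)

IsEmpty : {A B : Set} → ((A → B) → Set) → Set
IsEmpty {A} {B} P = ∀ (σ : A → B) → ¬ P σ

module Submission where

open import Defs
open import Data.Nat using (ℕ; _+_)
open import Data.Fin using (Fin; zero; suc; toℕ)
open import Data.Product using (_×_)
open import Data.Sum using (_⊎_)
open import Relation.Binary.PropositionalEquality using (_≡_; _≢_)

open import Data.Nat using (zero; suc; _≤_; _<_; _≤′_; ≤′-refl; ≤′-step; z≤n; s≤s)
open import Data.Nat.Properties using (≤-refl; m≤n⇒m≤1+n; <-trans; <⇒≤; n<1+n; m<n⇒m<1+n; <-irrefl; ≤⇒≤′)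
open import Data.Fin.Properties using (toℕ<n; suc-injective; 0≢1+n; _≟_)
open import Data.Product using (_,_)
open import Data.Sum as Sum using (inj₁; inj₂)
open import Data.Empty using (⊥-elim)
open import Function using (_∘_)
open import Function.Definitions using (Injective)
open import Relation.Nullary using (¬_; yes; no)
open import Relation.Binary.PropositionalEquality as ≡
  using (refl; trans; cong; subst; subst₂)

-- Under a homomorphism the centre and the v_i form a closed walk parallel to the cycle
-- C = θ γ₁ ⋯ γ_k θ, joined to it by the rungs through x and the u_i.  Each pair of
-- consecutive rungs of this ladder spans a closed 4-walk, which in a square-free graph
-- must collapse: the gadget walk either leads C by one step or lags one step behind.
-- Lagging persists along the ladder, because C does not backtrack.  Hence either the
-- gadget leads at the start, placing the centre at γ₁, or lags at the end, placing it
-- at γ_k; and a centre at γ₁ (resp. γ_k) forces leading (resp. lagging) all the way,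
-- which pins down every v_i.

module _ {A : Set} where

  padded : {k : ℕ} → (Fin k → A) → A → ℕ → A
  padded {zero}  f a _       = a
  padded {suc k} f a zero    = f zero
  padded {suc k} f a (suc m) = padded (f ∘ suc) a m

  closedWalk : {k : ℕ} → A → (Fin k → A) → ℕ → A
  closedWalk a f zero    = a
  closedWalk a f (suc m) = padded f a m

  padded-toℕ : {k : ℕ} {f : Fin k → A} {a : A} (i : Fin k) → padded f a (toℕ i) ≡ f i
  padded-toℕ {suc k} zero    = refl
  padded-toℕ {suc k} (suc i) = padded-toℕ i

  padded-end : {k : ℕ} {f : Fin k → A} {a : A} → padded f a k ≡ a
  padded-end {zero}  = refl
  padded-end {suc k} = padded-end {k}

  padded-≢ : {k : ℕ} {f : Fin k → A} {a x : A} →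
             a ≢ x → (∀ i → f i ≢ x) → ∀ m → padded f a m ≢ x
  padded-≢ {zero}  a≢x f≢x m       = a≢x
  padded-≢ {suc k} a≢x f≢x zero    = f≢x zero
  padded-≢ {suc k} a≢x f≢x (suc m) = padded-≢ a≢x (f≢x ∘ suc) m

  padded-distinct : {k : ℕ} {f : Fin k → A} {a : A} →
                     Injective _≡_ _≡_ f → (∀ i → f i ≢ a) →
                     ∀ {m m'} → m < k → m < m' → padded f a m ≢ padded f a m'
  padded-distinct {suc k} {f} f-inj fresh {zero} {suc m'} _ _ eq =
    padded-≢ {f = f ∘ suc} (fresh zero ∘ ≡.sym) (λ i e → 0≢1+n (≡.sym (f-inj e))) m' (≡.sym eq)
  padded-distinct {suc k} f-inj fresh {suc m} {suc m'} (s≤s m<k) (s≤s m<m') =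
    padded-distinct (suc-injective ∘ f-inj) (fresh ∘ suc) m<k m<m'

  closedWalk-nonbacktracking : {k : ℕ} {f : Fin k → A} {a : A} →
                               Injective _≡_ _≡_ f → (∀ i → f i ≢ a) → 1 < k →
                               ∀ m → m < k → closedWalk a f m ≢ closedWalk a f (suc (suc m))
  closedWalk-nonbacktracking {suc zero}    f-inj fresh (s≤s ()) zero _
  closedWalk-nonbacktracking {suc (suc k)} f-inj fresh _ zero _ eq = fresh (suc zero) (≡.sym eq)
  closedWalk-nonbacktracking f-inj fresh _ (suc m) m<k =
    padded-distinct f-inj fresh (<-trans (n<1+n m) m<k) (m<n⇒m<1+n (n<1+n m))

module _ {A B : Set} (R : A → B → Set) where

  padded-pointwise : {k : ℕ} {f : Fin k → A} {g : Fin k → B} {a : A} {b : B} →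
                     R a b → (∀ i → R (f i) (g i)) → ∀ m → R (padded f a m) (padded g b m)
  padded-pointwise {zero}  Rab Rfg m       = Rab
  padded-pointwise {suc k} Rab Rfg zero    = Rfg zero
  padded-pointwise {suc k} Rab Rfg (suc m) = padded-pointwise Rab (Rfg ∘ suc) m

  closedWalk-pointwise : {k : ℕ} {f : Fin k → A} {g : Fin k → B} {a : A} {b : B} →
                         R a b → (∀ i → R (f i) (g i)) →
                         ∀ m → R (closedWalk a f m) (closedWalk b g m)
  closedWalk-pointwise Rab Rfg zero    = Rab
  closedWalk-pointwise Rab Rfg (suc m) = padded-pointwise Rab Rfg m

record IsClosedWalk {A : Set} (R : A → A → Set) {k : ℕ} (a : A) (f : Fin k → A) : Set where
  field
    first : ∀ i → toℕ i ≡ 0 → R a (f i)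
    step  : ∀ i j → toℕ j ≡ suc (toℕ i) → R (f i) (f j)
    last  : ∀ i → suc (toℕ i) ≡ k → R (f i) a

module _ {A : Set} {R : A → A → Set} where

  padded-step : {k : ℕ} {f : Fin k → A} {a : A} →
                (∀ i j → toℕ j ≡ suc (toℕ i) → R (f i) (f j)) →
                (∀ i → suc (toℕ i) ≡ k → R (f i) a) →
                ∀ m → suc m ≤ k → R (padded f a m) (padded f a (suc m))
  padded-step {suc zero}    step last zero _ = last zero refl
  padded-step {suc (suc k)} step last zero _ = step zero (suc zero) refl
  padded-step {suc k} step last (suc m) (s≤s m<k) =
    padded-step (λ i j e → step (suc i) (suc j) (cong suc e))
                (λ i e → last (suc i) (cong suc e)) m m<k

  closedWalk-step : {k : ℕ} {f : Fin k → A} {a : A} → IsClosedWalk R a f → 0 < k →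
                    ∀ m → m ≤ k → R (closedWalk a f m) (closedWalk a f (suc m))
  closedWalk-step {suc k} walk _ zero    _   = IsClosedWalk.first walk zero refl
  closedWalk-step {suc k} walk _ (suc m) m<k =
    padded-step (IsClosedWalk.step walk) (IsClosedWalk.last walk) m m<k

module _ (H : Graph) where

  Adj⇒≢ : ∀ {a b} → Adj H a b → a ≢ b
  Adj⇒≢ ab refl = irrefl H ab

  square-free⇒diagonal : SquareFree H → ∀ {p q w w'} →
                         Adj H p q → Adj H p w → Adj H w w' → Adj H w' q → w' ≡ p ⊎ w ≡ q
  square-free⇒diagonal square-free {p} {q} {w} {w'} pq pw ww' w'q with w' ≟ p | w ≟ q
  ... | yes e   | _       = inj₁ e
  ... | no _    | yes e   = inj₂ e
  ... | no w'≢p | no w≢q =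
    ⊥-elim (square-free p w w' q (Adj⇒≢ pw) (w'≢p ∘ ≡.sym) (Adj⇒≢ pq) (Adj⇒≢ ww') w≢q (Adj⇒≢ w'q)
                         pw ww' w'q (sym H pq))

module Ladder (H : Graph) (square-free : SquareFree H) (L : ℕ) (P W : ℕ → Fin (n H))
  (P-step : ∀ m → m ≤ L → Adj H (P m) (P (suc m)))
  (W-step : ∀ m → m ≤ L → Adj H (W m) (W (suc m)))
  (rung : ∀ m → m ≤ suc L → Adj H (W m) (P m))
  (P-nonbacktracking : ∀ m → m < L → P m ≢ P (suc (suc m)))
  where

  Lead Lag : ℕ → Set
  Lead m = W m ≡ P (suc m)
  Lag  m = W (suc m) ≡ P m

  lag-or-lead : ∀ m → m ≤ L → Lag m ⊎ Lead m
  lag-or-lead m m≤L = square-free⇒diagonal H square-free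
    (P-step m m≤L) (sym H (rung m (m≤n⇒m≤1+n m≤L))) (W-step m m≤L) (rung (suc m) (s≤s m≤L))

  lag-step : ∀ m → suc m ≤ L → Lag m → Lag (suc m)
  lag-step m m<L lag with lag-or-lead (suc m) m<L
  ... | inj₁ lag′ = lag′
  ... | inj₂ lead = ⊥-elim (P-nonbacktracking m m<L (trans (≡.sym lag) lead))

  lag-persists : ∀ {m m'} → m ≤′ m' → m' ≤ L → Lag m → Lag m'
  lag-persists ≤′-refl          _    lag = lag
  lag-persists (≤′-step m≤′m') m'<L lag = lag-step _ m'<L (lag-persists m≤′m' (<⇒≤ m'<L) lag)

  lead-or-lag : Lead 0 ⊎ Lag L
  lead-or-lag with lag-or-lead 0 z≤n
  ... | inj₁ lag  = inj₂ (lag-persists (≤⇒≤′ z≤n) ≤-refl lag)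
  ... | inj₂ lead = inj₁ lead

  lead-everywhere : ¬ Lag L → ∀ m → m ≤ L → Lead m
  lead-everywhere ¬lag m m≤L with lag-or-lead m m≤L
  ... | inj₁ lag  = ⊥-elim (¬lag (lag-persists (≤⇒≤′ m≤L) ≤-refl lag))
  ... | inj₂ lead = lead

  lag-everywhere : ¬ Lead 0 → ∀ m → m ≤ L → Lag m
  lag-everywhere ¬lead m m≤L with lag-or-lead 0 z≤n
  ... | inj₁ lag  = lag-persists (≤⇒≤′ z≤n) m≤L lag
  ... | inj₂ lead = ⊥-elim (¬lead lead)

cardOne-intro : {A B : Set} {P : (A → B) → Set} (τ : A → B) → P τ →
                (∀ σ → P σ → ∀ a → σ a ≡ τ a) → CardOne P
cardOne-intro τ Pτ unique =
  (τ , Pτ) , λ σ σ' Pσ Pσ' a → trans (unique σ Pσ a) (≡.sym (unique σ' Pσ' a))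

module CycleGadget (H : Graph) (square-free : SquareFree H)
  {k : ℕ} {θ : Fin (n H)} {γ : Fin k → Fin (n H)} (cycle : IsCycle H k θ γ)
  {i₁ iₖ : Fin k} (i₁-first : toℕ i₁ ≡ 0) (iₖ-last : 1 + toℕ iₖ ≡ k)
  where

  open IsCycle cycle

  0<k : 0 < k
  0<k = <-trans (s≤s z≤n) len

  C : ℕ → Fin (n H)
  C = closedWalk θ γ

  C-walk : IsClosedWalk (Adj H) θ γ
  C-walk = record { first = first ; step = step ; last = last }

  C-step : ∀ m → m ≤ k → Adj H (C m) (C (suc m))
  C-step = closedWalk-step C-walk 0<k

  C-adj : ∀ {m m'} → m' ≡ suc m → m ≤ k → Adj H (C m) (C m')
  C-adj refl = C-step _

  C-γ : ∀ i → C (suc (toℕ i)) ≡ γ i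
  C-γ = padded-toℕ

  C-first : C 1 ≡ γ i₁
  C-first = subst (λ m → C (suc m) ≡ γ i₁) i₁-first (C-γ i₁)

  C-last : C k ≡ γ iₖ
  C-last = subst (λ m → C m ≡ γ iₖ) iₖ-last (C-γ iₖ)

  C-end : C (suc k) ≡ θ
  C-end = padded-end {k = k}

  γ₁≢γₖ : γ i₁ ≢ γ iₖ
  γ₁≢γₖ eq = <-irrefl refl (subst (1 <_) k≡1 len)
    where
    k≡1 : k ≡ 1
    k≡1 = trans (≡.sym iₖ-last) (cong suc (trans (cong toℕ (≡.sym (γ-inj eq))) i₁-first))

  module _ {σ : GV k → Fin (n H)} (σ-hom : IsGadgetHom H k θ γ σ) where

    open IsGadgetHom σ-hom

    W : ℕ → Fin (n H)
    W = closedWalk (σ c) (σ ∘ v)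

    W-walk : IsClosedWalk (Adj H) (σ c) (σ ∘ v)
    W-walk = record
      { first = λ i e → hom _ _ (e-sv1 i e)
      ; step  = λ i j e → hom _ _ (e-vv i j e)
      ; last  = λ i e → hom _ _ (e-vks i e)
      }

    W-rung : ∀ m → Adj H (W m) (C m)
    W-rung = closedWalk-pointwise (Adj H)
      (subst (Adj H (σ c)) pin-x (hom _ _ e-sx))
      (λ i → subst (Adj H (σ (v i))) (pin-u i) (hom _ _ (e-vu i)))

    open Ladder H square-free k C W C-step (closedWalk-step W-walk 0<k) (λ m _ → W-rung m)
                (closedWalk-nonbacktracking γ-inj θ-fresh len)

    lead⇒centre : Lead 0 → σ c ≡ γ i₁
    lead⇒centre lead = trans lead C-first

    lag⇒centre : Lag k → σ c ≡ γ iₖ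
    lag⇒centre lag = trans (≡.sym (padded-end {k = k})) (trans lag C-last)

    centre-endpoint : σ c ≡ γ i₁ ⊎ σ c ≡ γ iₖ
    centre-endpoint = Sum.map lead⇒centre lag⇒centre lead-or-lag

    v-leading : σ c ≡ γ i₁ → ∀ i → σ (v i) ≡ C (suc (suc (toℕ i)))
    v-leading centre i = trans (≡.sym (padded-toℕ i)) (lead-everywhere ¬lag (suc (toℕ i)) (toℕ<n i))
      where
      ¬lag : ¬ Lag k
      ¬lag lag = γ₁≢γₖ (trans (≡.sym centre) (lag⇒centre lag))

    v-lagging : σ c ≡ γ iₖ → ∀ i → σ (v i) ≡ C (toℕ i)
    v-lagging centre i = trans (≡.sym (padded-toℕ i)) (lag-everywhere ¬lead (toℕ i) (<⇒≤ (toℕ<n i)))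
      where
      ¬lead : ¬ Lead 0
      ¬lead lead = γ₁≢γₖ (trans (≡.sym (lead⇒centre lead)) centre)

  extend : Fin (n H) → (Fin k → Fin (n H)) → GV k → Fin (n H)
  extend g w c     = g
  extend g w x     = θ
  extend g w (v i) = w i
  extend g w (u i) = γ i

  hom-agrees-with-extend : ∀ {σ g w} → IsGadgetHom H k θ γ σ →
                           σ c ≡ g → (∀ i → σ (v i) ≡ w i) → ∀ a → σ a ≡ extend g w a
  hom-agrees-with-extend σ-hom centre σv c     = centre
  hom-agrees-with-extend σ-hom centre σv x     = IsGadgetHom.pin-x σ-hom
  hom-agrees-with-extend σ-hom centre σv (v i) = σv i
  hom-agrees-with-extend σ-hom centre σv (u i) = IsGadgetHom.pin-u σ-hom i

  -- C m is the paper's γ_m, with γ₀ = γ_{k+1} = θ, and v i is v_{toℕ i + 1}: leading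
  -- sends v_j to γ_{j+1} and lagging sends v_j to γ_{j−1}.
  leading lagging : GV k → Fin (n H)
  leading = extend (γ i₁) (λ i → C (suc (suc (toℕ i))))
  lagging = extend (γ iₖ) (C ∘ toℕ)

  leading-hom : IsGadgetHom H k θ γ leading
  leading-hom = record { hom = edge ; pin-u = λ _ → refl ; pin-x = refl }
    where
    edge : ∀ a b → GE k a b → Adj H (leading a) (leading b)
    edge _ _ (e-vv i j eq) = C-adj (cong (2 +_) eq) (subst (λ m → suc m ≤ k) eq (toℕ<n j))
    edge _ _ (e-vu i)      = subst (Adj H _) (C-γ i) (sym H (C-step (suc (toℕ i)) (toℕ<n i)))
    edge _ _ (e-sv1 i eq)  =
      subst₂ (Adj H) C-first (cong (λ m → C (2 + m)) (≡.sym eq)) (C-step 1 (<⇒≤ len))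
    edge _ _ (e-vks i eq)  =
      subst (λ a → Adj H a (γ i₁)) (≡.sym (trans (cong (C ∘ suc) eq) C-end)) (first i₁ i₁-first)
    edge _ _ e-sx          = sym H (first i₁ i₁-first)

  lagging-hom : IsGadgetHom H k θ γ lagging
  lagging-hom = record { hom = edge ; pin-u = λ _ → refl ; pin-x = refl }
    where
    edge : ∀ a b → GE k a b → Adj H (lagging a) (lagging b)
    edge _ _ (e-vv i j eq) = C-adj eq (<⇒≤ (toℕ<n i))
    edge _ _ (e-vu i)      = subst (Adj H _) (C-γ i) (C-step (toℕ i) (<⇒≤ (toℕ<n i)))
    edge _ _ (e-sv1 i eq)  = subst (Adj H (γ iₖ) ∘ C) (≡.sym eq) (last iₖ iₖ-last)
    edge _ _ (e-vks i eq)  = subst (Adj H _) C-last (C-adj (≡.sym eq) (<⇒≤ (toℕ<n i)))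
    edge _ _ e-sx          = last iₖ iₖ-last

  homAt-endpoint-unique : ∀ g → g ≡ γ i₁ ⊎ g ≡ γ iₖ → CardOne (IsHomAt H k θ γ g)
  homAt-endpoint-unique _ (inj₁ refl) = cardOne-intro leading (leading-hom , refl)
    λ σ (σ-hom , centre) → hom-agrees-with-extend σ-hom centre (v-leading σ-hom centre)
  homAt-endpoint-unique _ (inj₂ refl) = cardOne-intro lagging (lagging-hom , refl)
    λ σ (σ-hom , centre) → hom-agrees-with-extend σ-hom centre (v-lagging σ-hom centre)

  homAt-empty : ∀ {g} → g ≢ γ i₁ → g ≢ γ iₖ → IsEmpty (IsHomAt H k θ γ g)
  homAt-empty g≢γ₁ g≢γₖ σ (σ-hom , refl) = Sum.[ g≢γ₁ , g≢γₖ ] (centre-endpoint σ-hom)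

lemma6 : (H : Graph) → SquareFree H →
    (k : ℕ) (θ : Fin (n H)) (γ : Fin k → Fin (n H)) → IsCycle H k θ γ →
    (i₁ iₖ : Fin k) → toℕ i₁ ≡ 0 → 1 + toℕ iₖ ≡ k →
    ((∀ σ → IsHomJCL H k θ γ σ → (σ c ≡ γ i₁ ⊎ σ c ≡ γ iₖ))
      × (∀ σ → IsHomJCR H k θ γ σ → (σ c ≡ γ i₁ ⊎ σ c ≡ γ iₖ)))
    × (∀ g → (g ≡ γ i₁ ⊎ g ≡ γ iₖ) →
        CardOne (IsHomJCL-at H k θ γ g) × CardOne (IsHomJCR-at H k θ γ g))
    × (∀ g → g ≢ γ i₁ → g ≢ γ iₖ →
        IsEmpty (IsHomJCL-at H k θ γ g) × IsEmpty (IsHomJCR-at H k θ γ g))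
lemma6 H square-free k θ γ cycle i₁ iₖ i₁-first iₖ-last =
  ((λ _ → centre-endpoint) , (λ _ → centre-endpoint))
  , (λ g endpoint → homAt-endpoint-unique g endpoint , homAt-endpoint-unique g endpoint)
  , (λ g g≢γ₁ g≢γₖ → homAt-empty g≢γ₁ g≢γₖ , homAt-empty g≢γ₁ g≢γₖ)
  where open CycleGadget H square-free cycle i₁-first iₖ-last
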